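{- Every even binary word (over $\{\mathtt0,\mathtt1\}$) in which all $\mathtt0$-runs have length two and all $\mathtt1$-runs have length at most two is a shuffle square, unless it is of the form $(\mathtt{1001})^n$ for some odd $n$.
   Context: A run of a word is a maximal block of consecutive equal letters; a $w$-run is a run consisting of the letter $w$. A word is even if each letter occurs an even number of times. $U^n$ denotes the concatenation of $n$ copies of the word $U$. A word $W$ is a shuffle square if its positions can be partitioned into the supports of two subsequences that are equal as words. -}

module Defs where

open import Data.Bool using (Bool; true; false; if_then_else_)
open import Data.Nat using (ℕ; zero; suc; _≤_)
open import Data.Nat.Properties using ()
open import Data.List using (List; []; _∷_; _++_; filter; length; concat; replicate)
open import Data.List.Relation.Unary.All using (All)
open import Data.Product using (_×_; _,_; Σ; ∃)
open import Data.Bool.Properties using (_≟_)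
open import Relation.Nullary using (Dec; yes; no)
open import Relation.Binary.PropositionalEquality using (_≡_)
open import Data.Nat.Divisibility using (_∣_)

-- Binary words over {0,1}: the letter 0 is 'false', the letter 1 is 'true'.
Word : Set
Word = List Bool

count : Bool → Word → ℕ
count b [] = 0
count b (x ∷ xs) with x ≟ b
... | yes _ = suc (count b xs)
... | no  _ = count b xs

Even : Word → Set
Even w = (b : Bool) → 2 ∣ count b w

runs : Word → List (Bool × ℕ)
runs [] = []
runs (x ∷ xs) with runs xs
... | [] = (x , 1) ∷ []
... | (y , k) ∷ rs with x ≟ y
...   | yes _ = (y , suc k) ∷ rs
...   | no  _ = (x , 1) ∷ (y , k) ∷ rs

GoodRun : Bool × ℕ → Set
GoodRun (false , k) = k ≡ 2
GoodRun (true  , k) = k ≤ 2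

select : Bool → (w : Word) → List Bool → Word
select b [] _ = []
select b (x ∷ xs) [] = []
select b (x ∷ xs) (l ∷ ls) with l ≟ b
... | yes _ = x ∷ select b xs ls
... | no  _ = select b xs ls

-- W is a shuffle square: its positions can be split into two classes
-- (labelling each position by a Bool) whose subsequences are equal words
ShuffleSquare : Word → Set
ShuffleSquare w =
  Σ (List Bool) λ lab → length lab ≡ length w × select false w lab ≡ select true w lab

pow : Word → ℕ → Word
pow u n = concat (replicate n u)

w1001 : Word
w1001 = true ∷ false ∷ false ∷ true ∷ []

Odd : ℕ → Set
Odd n = ∃ λ k → n ≡ suc (2 Data.Nat.* k)

-- Read from the left, such a word factors into 00, 11 and blocks (1001)^n with
-- n ≥ 1, each block preceded by a 00 unless it begins the word and followed by
-- one unless it ends it.  Shuffle squares are closed under concatenation and u u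
-- is one for every word u, so if u and u 1001 are shuffle squares then so is
-- u (1001)^n for every n.  This applies to u = 00, which absorbs the block after
-- it.  A block (1001)^n with n odd at the start of the word instead lends its last
-- 1001 to the following 00, and u = 100100 qualifies as well, 1001001001 being
-- a shuffle square.  Only the word (1001)^n with n odd has nothing to pair with.
{-# OPTIONS --safe #-}
module Submission where

open import Defs
open import Data.Nat using (ℕ; zero; suc; pred; _+_; _*_; s≤s)
open import Data.Nat.Properties using (+-suc; +-comm; +-identityʳ)
open import Data.Nat.Divisibility using (_∣_; ∣-refl; ∣1⇒≡1; ∣m+n∣m⇒∣n)
open import Data.Bool using (Bool; true; false)
open import Data.Bool.Properties using (_≟_)
open import Data.List using (List; []; _∷_; [_]; _++_; length; replicate)
open import Data.List.Properties using (++-assoc; ++-identityʳ; length-++; length-replicate)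
open import Data.List.Relation.Unary.All using (All; _∷_)
import Data.List.Relation.Unary.All as All
open import Data.Product using (Σ; ∃₂; _×_; _,_; proj₁; proj₂)
open import Data.Sum using (_⊎_; inj₁; inj₂)
open import Data.Empty using (⊥-elim)
open import Relation.Binary.PropositionalEquality
  using (_≡_; _≢_; refl; sym; trans; cong; cong₂; subst; module ≡-Reasoning)
open import Relation.Nullary using (¬_; yes; no)

pattern O = false
pattern I = true

data EvenOrOdd : ℕ → Set where
  even : ∀ k → EvenOrOdd (2 * k)
  odd  : ∀ k → EvenOrOdd (suc (2 * k))

evenOrOdd : ∀ n → EvenOrOdd n
evenOrOdd zero = even 0
evenOrOdd (suc n) with evenOrOdd n
... | even k = odd k
... | odd k  = subst EvenOrOdd (cong suc (+-suc k (k + 0))) (even (suc k))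

2∣2+n⇒2∣n : ∀ {n} → 2 ∣ 2 + n → 2 ∣ n
2∣2+n⇒2∣n p = ∣m+n∣m⇒∣n p ∣-refl

2∤1 : ¬ 2 ∣ 1
2∤1 p with ∣1⇒≡1 p
... | ()

select-++ : ∀ b (u v : Word) (l l′ : List Bool) → length l ≡ length u →
            select b (u ++ v) (l ++ l′) ≡ select b u l ++ select b v l′
select-++ b []      v []      l′ refl = refl
select-++ b (x ∷ u) v (c ∷ l) l′ eq with c ≟ b
... | yes _ = cong (x ∷_) (select-++ b u v l l′ (cong pred eq))
... | no  _ = select-++ b u v l l′ (cong pred eq)

select-replicate-≡ : ∀ b (u : Word) → select b u (replicate (length u) b) ≡ u
select-replicate-≡ b []      = refl
select-replicate-≡ b (x ∷ u) with b ≟ b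
... | yes _  = cong (x ∷_) (select-replicate-≡ b u)
... | no b≢b = ⊥-elim (b≢b refl)

select-replicate-≢ : ∀ {b c} → c ≢ b → (u : Word) →
                     select b u (replicate (length u) c) ≡ []
select-replicate-≢ c≢b []      = refl
select-replicate-≢ {b} {c} c≢b (x ∷ u) with c ≟ b
... | yes c≡b = ⊥-elim (c≢b c≡b)
... | no  _   = select-replicate-≢ c≢b u

ss-++ : ∀ u v → ShuffleSquare u → ShuffleSquare v → ShuffleSquare (u ++ v)
ss-++ u v (l , ∣l∣ , l-sq) (l′ , ∣l′∣ , l′-sq) =
    l ++ l′
  , trans (length-++ l) (trans (cong₂ _+_ ∣l∣ ∣l′∣) (sym (length-++ u)))
  , trans (select-++ O u v l l′ ∣l∣)
      (trans (cong₂ _++_ l-sq l′-sq) (sym (select-++ I u v l l′ ∣l∣)))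

ss-double : ∀ u → ShuffleSquare (u ++ u)
ss-double u = lab , ∣lab∣ , (begin
    select O (u ++ u) lab                ≡⟨ select-++ O u u left right (length-replicate n) ⟩
    select O u left ++ select O u right  ≡⟨ cong₂ _++_ (select-replicate-≡ O u)
                                                       (select-replicate-≢ (λ ()) u) ⟩
    u ++ []                              ≡⟨ ++-identityʳ u ⟩
    u                                    ≡⟨ cong₂ _++_ (select-replicate-≢ (λ ()) u)
                                                       (select-replicate-≡ I u) ⟨
    select I u left ++ select I u right  ≡⟨ select-++ I u u left right (length-replicate n) ⟨
    select I (u ++ u) lab                ∎)
  where
  open ≡-Reasoning
  n : ℕ
  n = length u
  left right lab : List Bool
  left  = replicate n O
  right = replicate n I
  lab   = left ++ right
  ∣lab∣ : length lab ≡ length (u ++ u)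
  ∣lab∣ = trans (length-++ left)
            (trans (cong₂ _+_ (length-replicate n) (length-replicate n)) (sym (length-++ u)))

pow-+ : ∀ u m n → pow u (m + n) ≡ pow u m ++ pow u n
pow-+ u zero    n = refl
pow-+ u (suc m) n = trans (cong (u ++_) (pow-+ u m n)) (sym (++-assoc u (pow u m) (pow u n)))

pow-suc : ∀ u n → pow u (suc n) ≡ pow u n ++ u
pow-suc u n = begin
  pow u (suc n)          ≡⟨ cong (pow u) (+-comm 1 n) ⟩
  pow u (n + 1)          ≡⟨ pow-+ u n 1 ⟩
  pow u n ++ (u ++ [])   ≡⟨ cong (pow u n ++_) (++-identityʳ u) ⟩
  pow u n ++ u           ∎
  where open ≡-Reasoning

ss-pow-even : ∀ u k → ShuffleSquare (pow u (2 * k))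
ss-pow-even u k = subst ShuffleSquare (sym pow-2k) (ss-double (pow u k))
  where
  pow-2k : pow u (2 * k) ≡ pow u k ++ pow u k
  pow-2k = trans (cong (λ m → pow u (k + m)) (+-identityʳ k)) (pow-+ u k k)

ss-pow : ∀ u n → ¬ Odd n → ShuffleSquare (pow u n)
ss-pow u n ¬odd with evenOrOdd n
... | even k = ss-pow-even u k
... | odd k  = ⊥-elim (¬odd (k , refl))

ss-++-pow : ∀ u v → ShuffleSquare u → ShuffleSquare (u ++ v) →
            ∀ n → ShuffleSquare (u ++ pow v n)
ss-++-pow u v u-sq uv-sq n with evenOrOdd n
... | even k = ss-++ u _ u-sq (ss-pow-even v k)
... | odd k  = subst ShuffleSquare (++-assoc u v (pow v (2 * k)))
                 (ss-++ (u ++ v) _ uv-sq (ss-pow-even v k))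

-- The words with good runs and an even number of 1s that are empty or begin
-- with 0 (resp. 1), with the 1-runs of length one grouped into blocks (1001)^n.
mutual
  data Even₀ : Word → Set where
    []   : Even₀ []
    00∷_ : ∀ {w} → Even₁ w → Even₀ (O ∷ O ∷ w)

  data Even₁ : Word → Set where
    []       : Even₁ []
    11∷_     : ∀ {w} → Even₀ w → Even₁ (I ∷ I ∷ w)
    1001^_∷_ : ∀ m {w} → Even₀ w → Even₁ (pow w1001 (suc m) ++ w)

mutual
  ss-even₀ : ∀ {w} → Even₀ w → ShuffleSquare w
  ss-even₀ []      = [] , refl , refl
  ss-even₀ (00∷ t) =
    ss-++-even₁ (O ∷ O ∷ []) (ss-double [ O ]) (ss-double (O ∷ O ∷ I ∷ [])) t

  ss-++-even₁ : ∀ u {w} → ShuffleSquare u → ShuffleSquare (u ++ w1001) → Even₁ w →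
                ShuffleSquare (u ++ w)
  ss-++-even₁ u u-sq _ [] = subst ShuffleSquare (sym (++-identityʳ u)) u-sq
  ss-++-even₁ u u-sq _ (11∷_ {w} e) =
    ss-++ u (I ∷ I ∷ w) u-sq (ss-++ (I ∷ I ∷ []) w (ss-double [ I ]) (ss-even₀ e))
  ss-++-even₁ u u-sq u1001-sq (1001^ m ∷ e) =
    subst ShuffleSquare (++-assoc u (pow w1001 (suc m)) _)
      (ss-++ (u ++ pow w1001 (suc m)) _ (ss-++-pow u w1001 u-sq u1001-sq (suc m)) (ss-even₀ e))

ss-1001^-++-00 : ∀ n {w} → Even₁ w → ShuffleSquare (pow w1001 n ++ O ∷ O ∷ w)
ss-1001^-++-00 n {w} t with evenOrOdd n
... | even k = ss-++ (pow w1001 (2 * k)) _ (ss-pow-even w1001 k) (ss-even₀ (00∷ t))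
... | odd k  = subst ShuffleSquare (sym last-block)
    (ss-++ (pow w1001 (2 * k)) _ (ss-pow-even w1001 k)
      (ss-++-even₁ w100100 (ss-double (I ∷ O ∷ O ∷ [])) ss-1001001001 t))
  where
  w100100 : Word
  w100100 = I ∷ O ∷ O ∷ I ∷ O ∷ O ∷ []
  -- 1001001001 is a shuffle of 10001 with itself
  ss-1001001001 : ShuffleSquare (w100100 ++ w1001)
  ss-1001001001 = O ∷ O ∷ O ∷ I ∷ O ∷ I ∷ O ∷ I ∷ I ∷ I ∷ [] , refl , refl
  last-block : pow w1001 (suc (2 * k)) ++ O ∷ O ∷ w ≡ pow w1001 (2 * k) ++ w100100 ++ w
  last-block = trans (cong (_++ O ∷ O ∷ w) (pow-suc w1001 (2 * k)))
                     (++-assoc (pow w1001 (2 * k)) w1001 (O ∷ O ∷ w))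

ss-even₁ : ∀ {w} → Even₁ w → ¬ (Σ ℕ λ n → Odd n × w ≡ pow w1001 n) → ShuffleSquare w
ss-even₁ []                    _    = [] , refl , refl
ss-even₁ (11∷_ {w} e)          _    = ss-++ (I ∷ I ∷ []) w (ss-double [ I ]) (ss-even₀ e)
ss-even₁ (1001^ m ∷ [])        ¬exc =
  subst ShuffleSquare (sym (++-identityʳ _))
    (ss-pow w1001 (suc m) (λ odd → ¬exc (suc m , odd , ++-identityʳ _)))
ss-even₁ (1001^ m ∷ (00∷ t))   _    = ss-1001^-++-00 (suc m) t

runs-head : ∀ x xs → ∃₂ λ k rs → runs (x ∷ xs) ≡ (x , suc k) ∷ rs
runs-head x xs with runs xs
... | [] = 0 , [] , refl
... | (y , k) ∷ rs with x ≟ y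
...   | yes refl = k , rs , refl
...   | no  _    = 0 , _ , refl

runs-∷-≡ : ∀ {x} xs {k rs} → runs (x ∷ xs) ≡ (x , k) ∷ rs →
           runs (x ∷ x ∷ xs) ≡ (x , suc k) ∷ rs
runs-∷-≡ {x} xs eq rewrite eq with x ≟ x
... | yes refl = refl
... | no  x≢x  = ⊥-elim (x≢x refl)

runs-∷-≢ : ∀ {x y} ys → x ≢ y → runs (x ∷ y ∷ ys) ≡ (x , 1) ∷ runs (y ∷ ys)
runs-∷-≢ {x} {y} ys x≢y with runs-head y ys
... | k , rs , eq rewrite eq with x ≟ y
...   | yes x≡y = ⊥-elim (x≢y x≡y)
...   | no  _   = refl

good-∷-≢ : ∀ {x y} ys → x ≢ y → All GoodRun (runs (x ∷ y ∷ ys)) →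
           GoodRun (x , 1) × All GoodRun (runs (y ∷ ys))
good-∷-≢ ys x≢y g = All.uncons (subst (All GoodRun) (runs-∷-≢ ys x≢y) g)

good-∷∷-≢ : ∀ {x y} ys → x ≢ y → All GoodRun (runs (x ∷ x ∷ y ∷ ys)) →
            GoodRun (x , 2) × All GoodRun (runs (y ∷ ys))
good-∷∷-≢ {y = y} ys x≢y g =
  All.uncons (subst (All GoodRun) (runs-∷-≡ (y ∷ ys) (runs-∷-≢ ys x≢y)) g)

¬good-∷∷∷ : ∀ x xs → ¬ All GoodRun (runs (x ∷ x ∷ x ∷ xs))
¬good-∷∷∷ x xs g with runs-head x xs
... | k , rs , eq =
  ¬good-3+ x (All.head (subst (All GoodRun) (runs-∷-≡ (x ∷ xs) (runs-∷-≡ xs eq)) g))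
  where
  ¬good-3+ : ∀ x → ¬ GoodRun (x , 3 + k)
  ¬good-3+ O ()
  ¬good-3+ I (s≤s (s≤s ()))

mutual
  data Good₀ : Word → Set where
    []   : Good₀ []
    00∷_ : ∀ {w} → Good₁ w → Good₀ (O ∷ O ∷ w)

  data Good₁ : Word → Set where
    []   : Good₁ []
    1∷_  : ∀ {w} → Good₀ w → Good₁ (I ∷ w)
    11∷_ : ∀ {w} → Good₀ w → Good₁ (I ∷ I ∷ w)

mutual
  good₀ : ∀ xs → All GoodRun (runs (O ∷ xs)) → Good₀ (O ∷ xs)
  good₀ []           (() ∷ _)
  good₀ (I ∷ xs)     g with proj₁ (good-∷-≢ xs (λ ()) g)
  ... | ()
  good₀ (O ∷ [])     _ = 00∷ []
  good₀ (O ∷ I ∷ xs) g = 00∷ good₁ xs (proj₂ (good-∷∷-≢ xs (λ ()) g))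
  good₀ (O ∷ O ∷ xs) g = ⊥-elim (¬good-∷∷∷ O xs g)

  good₁ : ∀ xs → All GoodRun (runs (I ∷ xs)) → Good₁ (I ∷ xs)
  good₁ []           _ = 1∷ []
  good₁ (O ∷ xs)     g = 1∷ good₀ xs (proj₂ (good-∷-≢ xs (λ ()) g))
  good₁ (I ∷ [])     _ = 11∷ []
  good₁ (I ∷ O ∷ xs) g = 11∷ good₀ xs (proj₂ (good-∷∷-≢ xs (λ ()) g))
  good₁ (I ∷ I ∷ xs) g = ⊥-elim (¬good-∷∷∷ I xs g)

good : ∀ w → All GoodRun (runs w) → Good₀ w ⊎ Good₁ w
good []       _ = inj₁ []
good (O ∷ xs) g = inj₁ (good₀ xs g)
good (I ∷ xs) g = inj₂ (good₁ xs g)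

mutual
  even₀ : ∀ {w} → Good₀ w → 2 ∣ count I w → Even₀ w
  even₀ []      _ = []
  even₀ (00∷ o) p = 00∷ even₁ o p

  even₁ : ∀ {w} → Good₁ w → 2 ∣ count I w → Even₁ w
  even₁ []      _ = []
  even₁ (1∷ z)  p with 1∷odd₀ z p
  ... | m , e , e-even , eq = subst Even₁ (sym eq) (1001^ m ∷ e-even)
  even₁ (11∷ z) p = 11∷ even₀ z (2∣2+n⇒2∣n p)

  1∷odd₀ : ∀ {w} → Good₀ w → 2 ∣ suc (count I w) →
              ∃₂ λ m e → Even₀ e × I ∷ w ≡ pow w1001 (suc m) ++ e
  1∷odd₀ []             p = ⊥-elim (2∤1 p)
  1∷odd₀ (00∷ [])       p = ⊥-elim (2∤1 p)
  1∷odd₀ (00∷ (1∷ z))   p = 0 , _ , even₀ z (2∣2+n⇒2∣n p) , refl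
  1∷odd₀ (00∷ (11∷ z))  p with 1∷odd₀ z (2∣2+n⇒2∣n p)
  ... | m , e , e-even , eq = suc m , e , e-even , cong (λ v → I ∷ O ∷ O ∷ I ∷ v) eq

proposition4p1 : (w : Word) → Even w → All GoodRun (runs w)
                 → ¬ (Σ ℕ λ n → Odd n × w ≡ pow w1001 n)
                 → ShuffleSquare w
proposition4p1 w w-even g ¬exc with good w g
... | inj₁ z = ss-even₀ (even₀ z (w-even I))
... | inj₂ o = ss-even₁ (even₁ o (w-even I)) ¬exc
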